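{- Let $p$ be a binary word of length $l$ having $r$ runs, of which $r_1$ have size $1$. For every $n \ge 0$, $$B_{n,p}(2) = \begin{cases} r_1 \dbinom{n-r}{l-r+1} & \text{if } l \ge 2,\\[2mm] \dbinom{n}{2} & \text{if } l = 1.\end{cases}$$
   Context: A binary word is a finite sequence $w = w_1 \cdots w_n$ with each $w_i \in \{0,1\}$; $n$ is its length. An occurrence of $p = p_1\cdots p_l$ in $w$ is a choice of indices $1 \le i_1 < \cdots < i_l \le n$ with $w_{i_1}\cdots w_{i_l} = p$. $c_p(w)$ is the number of occurrences of $p$ in $w$, and $B_{n,p}(k)$ is the number of binary words $w$ of length $n$ with $c_p(w)=k$. A run of $w$ is a maximal block of consecutive equal letters; its size is its length. Binomial coefficients are combinatorial: $\binom{a}{b}$ is the number of $b$-element subsets of an $a$-element set, and is $0$ when $b > a$ or $a < 0$. -}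

module Defs where

open import Data.Bool using (Bool; true; false; if_then_else_)
open import Data.Bool.Properties using () renaming (_≟_ to _≟ᵇ_)
open import Data.Nat using (ℕ; zero; suc; _+_; _≡ᵇ_)
open import Data.List using (List; []; _∷_; length; map; _++_; filter)
open import Relation.Nullary.Decidable using (does)

-- A binary word: list of Booleans (false = 0, true = 1).
Word : Set
Word = List Bool

words : ℕ → List Word
words zero = [] ∷ []
words (suc n) = map (false ∷_) (words n) ++ map (true ∷_) (words n)

-- c p w : number of occurrences of p in w as a (scattered) subsequence,
-- i.e. number of index tuples i₁ < … < iₗ with w_{i₁}…w_{iₗ} = p.
-- Standard recursion on the first letter of w: either w₁ is used as
-- the image of p₁ (only if they are equal) or it is not used.
occ : Word → Word → ℕ
occ [] w = 1
occ (a ∷ p) [] = 0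
occ (a ∷ p) (b ∷ w) = (if does (a ≟ᵇ b) then occ p w else 0) + occ (a ∷ p) w

B : ℕ → Word → ℕ → ℕ
B n p k = length (filter (λ w → occ p w Data.Nat.≟ k) (words n))

runSizes : Word → List ℕ
runSizes [] = []
runSizes (a ∷ w) with runSizes w | w
... | s ∷ ss | b ∷ _ = if does (a ≟ᵇ b) then suc s ∷ ss else 1 ∷ s ∷ ss
... | ss | _ = 1 ∷ ss

numRuns : Word → ℕ
numRuns w = length (runSizes w)

numRuns1 : Word → ℕ
numRuns1 w = length (filter (λ s → s Data.Nat.≟ 1) (runSizes w))

module Submission where

-- Split the words w by their first letter. For a pattern a ∷ q, a leading a contributes
-- occ (a ∷ q) (a ∷ w) = occ q w + occ (a ∷ q) w, and any other leading letter contributes nothing.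
-- Since occ (a ∷ q) w vanishes whenever occ q w does, the words of length m + 1 with two
-- occurrences of a ∷ q are the words of length m with two occurrences plus those in which
-- (occ q, occ (a ∷ q)) is (1, 1) or (2, 0). These joint counts, the (1, 0) count, and a
-- companion count for the pair q, b ∷ q arising where the pattern changes letter, satisfy a
-- closed system of recursions along the runs of the pattern. Each solution is a number of runs
-- of size 1 times C(m − k, j) for suitable k and j, and Pascal's rule closes every inductive step.

open import Data.Bool using (Bool; true; false; not; _∧_; _xor_; if_then_else_)
open import Data.Bool.Properties using (∧-zeroʳ) renaming (_≟_ to _≟ᵇ_)
open import Data.List using (List; []; _∷_; length; map; _++_; filter)
open import Data.List.Properties using (length-++; filter-++)
open import Data.Nat using (ℕ; zero; suc; _+_; _*_; _∸_; _≥_; _≡ᵇ_; _≟_; s≤s)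
open import Data.Nat.Combinatorics using (_C_; nCk+nC[k+1]≡[n+1]C[k+1])
open import Data.Nat.Properties using (+-commutativeSemigroup; +-comm; +-suc; +-identityʳ; *-zeroʳ; *-distribˡ-+; *-distribʳ-+; m+n≡0⇒n≡0; m+n∸m≡n)
open import Algebra.Properties.CommutativeSemigroup +-commutativeSemigroup using (interchange)
open import Data.Product using (_×_; _,_)
open import Function using (_∘_)
open import Relation.Binary.PropositionalEquality using (_≡_; refl; sym; trans; cong; cong₂; subst; module ≡-Reasoning)
open import Relation.Nullary.Decidable using (does)
open import Relation.Unary using (Pred; Decidable)
open ≡-Reasoning

open import Defs

-- In the identities below, x, y, z, t stand for the numbers of occurrences in one word of
-- patterns each obtained from the previous one by prepending a letter; hence each vanishes
-- whenever its predecessor does.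

x+y≡ᵇk∧y+z≡ᵇ0 : ∀ k x y z → (y ≡ 0 → z ≡ 0) →
                 ((x + y) ≡ᵇ k) ∧ ((y + z) ≡ᵇ 0) ≡ (x ≡ᵇ k) ∧ (y ≡ᵇ 0)
x+y≡ᵇk∧y+z≡ᵇ0 k x zero    z hy rewrite hy refl | +-identityʳ x = refl
x+y≡ᵇk∧y+z≡ᵇ0 k x (suc y) z hy = trans (∧-zeroʳ _) (sym (∧-zeroʳ _))

y≡ᵇ1+k∧y+z≡ᵇ0 : ∀ k y z → (y ≡ᵇ suc k) ∧ ((y + z) ≡ᵇ 0) ≡ false
y≡ᵇ1+k∧y+z≡ᵇ0 k zero    z = refl
y≡ᵇ1+k∧y+z≡ᵇ0 k (suc y) z = ∧-zeroʳ _

x+y≡ᵇ1∧z≡ᵇ0 : ∀ x y z → (x ≡ 0 → y ≡ 0) → (y ≡ 0 → z ≡ 0) →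
              ((x + y) ≡ᵇ 1) ∧ (z ≡ᵇ 0) ≡ (x ≡ᵇ 1) ∧ (y ≡ᵇ 0)
x+y≡ᵇ1∧z≡ᵇ0 x       zero    z hx hy rewrite hy refl | +-identityʳ x = refl
x+y≡ᵇ1∧z≡ᵇ0 zero    (suc y) z hx hy with () ← hx refl
x+y≡ᵇ1∧z≡ᵇ0 (suc x) (suc y) z hx hy rewrite +-comm x (suc y) = sym (∧-zeroʳ _)

x+y≡ᵇ1∧y+z≡ᵇ1 : ∀ x y z → (x ≡ 0 → y ≡ 0) → (y ≡ 0 → z ≡ 0) →
                ((x + y) ≡ᵇ 1) ∧ ((y + z) ≡ᵇ 1) ≡ false
x+y≡ᵇ1∧y+z≡ᵇ1 x       zero    z hx hy rewrite hy refl = ∧-zeroʳ _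
x+y≡ᵇ1∧y+z≡ᵇ1 zero    (suc y) z hx hy with () ← hx refl
x+y≡ᵇ1∧y+z≡ᵇ1 (suc x) (suc y) z hx hy rewrite +-comm x (suc y) = refl

y≡ᵇ1∧y+z≡ᵇ1 : ∀ y z → (y ≡ᵇ 1) ∧ ((y + z) ≡ᵇ 1) ≡ (y ≡ᵇ 1) ∧ (z ≡ᵇ 0)
y≡ᵇ1∧y+z≡ᵇ1 zero          z = refl
y≡ᵇ1∧y+z≡ᵇ1 (suc zero)    z = refl
y≡ᵇ1∧y+z≡ᵇ1 (suc (suc y)) z = refl

x+y≡ᵇ1∧z≡ᵇ1 : ∀ x y z → (x ≡ 0 → y ≡ 0) → (y ≡ 0 → z ≡ 0) →
              ((x + y) ≡ᵇ 1) ∧ (z ≡ᵇ 1) ≡ false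
x+y≡ᵇ1∧z≡ᵇ1 x       zero    z hx hy rewrite hy refl = ∧-zeroʳ _
x+y≡ᵇ1∧z≡ᵇ1 zero    (suc y) z hx hy with () ← hx refl
x+y≡ᵇ1∧z≡ᵇ1 (suc x) (suc y) z hx hy rewrite +-comm x (suc y) = refl

x+y+[y+z]≡ᵇ2∧t≡ᵇ0 : ∀ x y z t → (x ≡ 0 → y ≡ 0) → (y ≡ 0 → z ≡ 0) → (z ≡ 0 → t ≡ 0) →
                    (((x + y) + (y + z)) ≡ᵇ 2) ∧ (t ≡ᵇ 0) ≡ (x ≡ᵇ 2) ∧ (y ≡ᵇ 0)
x+y+[y+z]≡ᵇ2∧t≡ᵇ0 x       zero    z t hx hy hz rewrite hy refl | hz refl | +-identityʳ x | +-identityʳ x = refl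
x+y+[y+z]≡ᵇ2∧t≡ᵇ0 zero    (suc y) z t hx hy hz with () ← hx refl
x+y+[y+z]≡ᵇ2∧t≡ᵇ0 (suc x) (suc y) z t hx hy hz rewrite +-comm x (suc y) | +-comm (y + x) (suc (y + z)) = sym (∧-zeroʳ _)

y+[y+z]≡ᵇ2∧t≡ᵇ0 : ∀ y z t → (y ≡ 0 → z ≡ 0) → (z ≡ 0 → t ≡ 0) →
                  ((y + (y + z)) ≡ᵇ 2) ∧ (t ≡ᵇ 0) ≡ (y ≡ᵇ 1) ∧ (z ≡ᵇ 0)
y+[y+z]≡ᵇ2∧t≡ᵇ0 zero          z       t hy hz rewrite hy refl = refl
y+[y+z]≡ᵇ2∧t≡ᵇ0 (suc zero)    zero    t hy hz rewrite hz refl = refl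
y+[y+z]≡ᵇ2∧t≡ᵇ0 (suc zero)    (suc z) t hy hz = refl
y+[y+z]≡ᵇ2∧t≡ᵇ0 (suc (suc y)) z       t hy hz rewrite +-comm y (suc (suc (y + z))) = refl

x+y≡ᵇ2∧y≡ᵇ1 : ∀ x y → ((x + y) ≡ᵇ 2) ∧ (y ≡ᵇ 1) ≡ (x ≡ᵇ 1) ∧ (y ≡ᵇ 1)
x+y≡ᵇ2∧y≡ᵇ1 x y rewrite +-comm x y with y
... | zero          = trans (∧-zeroʳ _) (sym (∧-zeroʳ _))
... | suc zero      = refl
... | suc (suc y′)  = trans (∧-zeroʳ _) (sym (∧-zeroʳ _))

x+y≡ᵇ2∧y≢ᵇ1 : ∀ x y → (x ≡ 0 → y ≡ 0) → ((x + y) ≡ᵇ 2) ∧ not (y ≡ᵇ 1) ≡ (x ≡ᵇ 2) ∧ (y ≡ᵇ 0)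
x+y≡ᵇ2∧y≢ᵇ1 x       zero          hx rewrite +-identityʳ x = refl
x+y≡ᵇ2∧y≢ᵇ1 zero    (suc y)       hx with () ← hx refl
x+y≡ᵇ2∧y≢ᵇ1 (suc x) (suc zero)    hx = trans (∧-zeroʳ _) (sym (∧-zeroʳ _))
x+y≡ᵇ2∧y≢ᵇ1 (suc x) (suc (suc y)) hx rewrite +-comm x (suc (suc y)) = sym (∧-zeroʳ _)

-- (m ∸ k) C j, except that it is 0 when m < k; with this convention Pascal's rule holds for all m.
shiftedC : ℕ → ℕ → ℕ → ℕ
shiftedC zero    m       j = m C j
shiftedC (suc k) zero    j = 0
shiftedC (suc k) (suc m) j = shiftedC k m j

shiftedC-0 : ∀ k j → shiftedC k 0 (suc j) ≡ 0
shiftedC-0 zero    j = refl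
shiftedC-0 (suc k) j = refl

shiftedC-pascal : ∀ k m j → shiftedC k m j + shiftedC k m (suc j) ≡ shiftedC k (suc m) (suc j)
shiftedC-pascal zero    m       j = nCk+nC[k+1]≡[n+1]C[k+1] m j
shiftedC-pascal (suc k) zero    j = sym (shiftedC-0 k j)
shiftedC-pascal (suc k) (suc m) j = shiftedC-pascal k m j

shiftedC≡C : ∀ k m j → shiftedC k m (suc j) ≡ (m ∸ k) C suc j
shiftedC≡C zero    m       j = refl
shiftedC≡C (suc k) zero    j = refl
shiftedC≡C (suc k) (suc m) j = shiftedC≡C k m j

*-shiftedC-pascal : ∀ t k m j → t * shiftedC k m j + t * shiftedC k m (suc j) ≡ t * shiftedC k (suc m) (suc j)
*-shiftedC-pascal t k m j = trans (sym (*-distribˡ-+ t _ _)) (cong (t *_) (shiftedC-pascal k m j))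

-- a ∷ trail a ss is the word starting with a whose i-th letter after a differs from its
-- predecessor exactly when the i-th entry of ss is true. On this encoding the run statistics of
-- the pattern, and the letter following a, compute by structural recursion on ss.
trail : Bool → List Bool → Word
trail a []       = []
trail a (s ∷ ss) = (s xor a) ∷ trail (s xor a) ss

changes : Bool → Word → List Bool
changes a []      = []
changes a (b ∷ q) = (a xor b) ∷ changes b q

trail-changes : ∀ a q → trail a (changes a q) ≡ q
trail-changes a     []          = refl
trail-changes false (false ∷ q) = cong (false ∷_) (trail-changes false q)
trail-changes false (true ∷ q)  = cong (true ∷_) (trail-changes true q)
trail-changes true  (false ∷ q) = cong (false ∷_) (trail-changes false q)
trail-changes true  (true ∷ q)  = cong (true ∷_) (trail-changes true q)

length-trail : ∀ a ss → length (trail a ss) ≡ length ss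
length-trail a []       = refl
length-trail a (s ∷ ss) = cong suc (length-trail (s xor a) ss)

leadingRepeats : List Bool → ℕ
leadingRepeats (false ∷ ss) = suc (leadingRepeats ss)
leadingRepeats _            = 0

repeats : List Bool → ℕ
repeats []           = 0
repeats (false ∷ ss) = suc (repeats ss)
repeats (true ∷ ss)  = repeats ss

-- Written with an explicit suc so that isSingleton (firstRun ss) computes for ss = false ∷ _.
firstRun : List Bool → ℕ
firstRun ss = suc (leadingRepeats ss)

laterRuns : List Bool → List ℕ
laterRuns []           = []
laterRuns (false ∷ ss) = laterRuns ss
laterRuns (true ∷ ss)  = firstRun ss ∷ laterRuns ss

runs : List Bool → List ℕ
runs ss = firstRun ss ∷ laterRuns ss

runSizes-trail : ∀ a ss → runSizes (a ∷ trail a ss) ≡ runs ss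
runSizes-trail a []       = refl
runSizes-trail a (s ∷ ss) with runSizes ((s xor a) ∷ trail (s xor a) ss) | runSizes-trail (s xor a) ss
... | ._ | refl with s | a
... | false | false = refl
... | false | true  = refl
... | true  | false = refl
... | true  | true  = refl

length≡laterRuns+repeats : ∀ ss → length ss ≡ length (laterRuns ss) + repeats ss
length≡laterRuns+repeats []           = refl
length≡laterRuns+repeats (false ∷ ss) = trans (cong suc (length≡laterRuns+repeats ss)) (sym (+-suc _ _))
length≡laterRuns+repeats (true ∷ ss)  = cong suc (length≡laterRuns+repeats ss)

isSingleton : ℕ → ℕ
isSingleton 1 = 1
isSingleton _ = 0

singletons : List ℕ → ℕ
singletons []       = 0
singletons (x ∷ xs) = isSingleton x + singletons xs

length-filter-≟1 : ∀ xs → length (filter (_≟ 1) xs) ≡ singletons xs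
length-filter-≟1 []                 = refl
length-filter-≟1 (zero ∷ xs)        = length-filter-≟1 xs
length-filter-≟1 (suc zero ∷ xs)    = cong suc (length-filter-≟1 xs)
length-filter-≟1 (suc (suc x) ∷ xs) = length-filter-≟1 xs

numRuns-trail : ∀ a ss → numRuns (a ∷ trail a ss) ≡ length (runs ss)
numRuns-trail a ss = cong length (runSizes-trail a ss)

numRuns1-trail : ∀ a ss → numRuns1 (a ∷ trail a ss) ≡ singletons (runs ss)
numRuns1-trail a ss = trans (cong (λ xs → length (filter (_≟ 1) xs)) (runSizes-trail a ss)) (length-filter-≟1 (runs ss))

length∸numRuns-trail : ∀ a ss → length (a ∷ trail a ss) ∸ numRuns (a ∷ trail a ss) ≡ repeats ss
length∸numRuns-trail a ss = begin
  suc (length (trail a ss)) ∸ numRuns (a ∷ trail a ss)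
    ≡⟨ cong₂ (λ l r → suc l ∸ r) (length-trail a ss) (numRuns-trail a ss) ⟩
  length ss ∸ length (laterRuns ss)
    ≡⟨ cong (_∸ length (laterRuns ss)) (length≡laterRuns+repeats ss) ⟩
  length (laterRuns ss) + repeats ss ∸ length (laterRuns ss)
    ≡⟨ m+n∸m≡n (length (laterRuns ss)) (repeats ss) ⟩
  repeats ss ∎

count : ℕ → (Word → Bool) → ℕ
count zero    P = if P [] then 1 else 0
count (suc m) P = count m (λ w → P (false ∷ w)) + count m (λ w → P (true ∷ w))

count-cong : ∀ m {P Q : Word → Bool} → (∀ w → P w ≡ Q w) → count m P ≡ count m Q
count-cong zero    P≗Q = cong (λ b → if b then 1 else 0) (P≗Q [])
count-cong (suc m) P≗Q = cong₂ _+_ (count-cong m (P≗Q ∘ (false ∷_))) (count-cong m (P≗Q ∘ (true ∷_)))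

count-none : ∀ m → count m (λ _ → false) ≡ 0
count-none zero    = refl
count-none (suc m) = cong₂ _+_ (count-none m) (count-none m)

count-split : ∀ a m (P : Word → Bool) →
              count (suc m) P ≡ count m (λ w → P (a ∷ w)) + count m (λ w → P (not a ∷ w))
count-split false m P = refl
count-split true  m P = +-comm (count m (λ w → P (false ∷ w))) _

count-step : ∀ a m (P : Word → Bool) {Q R : Word → Bool} →
             (∀ w → P (a ∷ w) ≡ Q w) → (∀ w → P (not a ∷ w) ≡ R w) →
             count (suc m) P ≡ count m Q + count m R
count-step a m P on-a on-not-a = trans (count-split a m P) (cong₂ _+_ (count-cong m on-a) (count-cong m on-not-a))

count-partition : ∀ m (P Q : Word → Bool) →
                  count m P ≡ count m (λ w → P w ∧ Q w) + count m (λ w → P w ∧ not (Q w))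
count-partition zero P Q with P [] | Q []
... | false | _     = refl
... | true  | true  = refl
... | true  | false = refl
count-partition (suc m) P Q = begin
  count m P₀ + count m P₁
    ≡⟨ cong₂ _+_ (count-partition m P₀ (Q ∘ (false ∷_))) (count-partition m P₁ (Q ∘ (true ∷_))) ⟩
  (a + b) + (c + d)
    ≡⟨ interchange a b c d ⟩
  (a + c) + (b + d) ∎
  where
  P₀ = P ∘ (false ∷_)
  P₁ = P ∘ (true ∷_)
  a = count m (λ w → P₀ w ∧ Q (false ∷ w))
  b = count m (λ w → P₀ w ∧ not (Q (false ∷ w)))
  c = count m (λ w → P₁ w ∧ Q (true ∷ w))
  d = count m (λ w → P₁ w ∧ not (Q (true ∷ w)))

length-filter-map : ∀ {ℓ} {P : Pred Word ℓ} (P? : Decidable P) (f : Word → Word) xs →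
                    length (filter P? (map f xs)) ≡ length (filter (P? ∘ f) xs)
length-filter-map P? f []       = refl
length-filter-map P? f (x ∷ xs) with does (P? (f x))
... | true  = cong suc (length-filter-map P? f xs)
... | false = length-filter-map P? f xs

B≡count : ∀ n p k → B n p k ≡ count n (λ w → occ p w ≡ᵇ k)
B≡count n p k = go n (occ p)
  where
  go : ∀ n (f : Word → ℕ) → length (filter (λ w → f w ≟ k) (words n)) ≡ count n (λ w → f w ≡ᵇ k)
  go zero f with f [] ≡ᵇ k
  ... | true  = refl
  ... | false = refl
  go (suc n) f = begin
    length (filter F? (map (false ∷_) (words n) ++ map (true ∷_) (words n)))
      ≡⟨ cong length (filter-++ F? (map (false ∷_) (words n)) _) ⟩
    length (filter F? (map (false ∷_) (words n)) ++ filter F? (map (true ∷_) (words n)))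
      ≡⟨ length-++ (filter F? (map (false ∷_) (words n))) ⟩
    length (filter F? (map (false ∷_) (words n))) + length (filter F? (map (true ∷_) (words n)))
      ≡⟨ cong₂ _+_ (trans (length-filter-map F? (false ∷_) (words n)) (go n (f ∘ (false ∷_))))
                   (trans (length-filter-map F? (true ∷_) (words n)) (go n (f ∘ (true ∷_)))) ⟩
    count (suc n) (λ w → f w ≡ᵇ k) ∎
    where F? = λ w → f w ≟ k

occ-∷-∷ : ∀ a p w → occ (a ∷ p) (a ∷ w) ≡ occ p w + occ (a ∷ p) w
occ-∷-∷ false p w = refl
occ-∷-∷ true  p w = refl

occ-∷-not∷ : ∀ a p w → occ (a ∷ p) (not a ∷ w) ≡ occ (a ∷ p) w
occ-∷-not∷ false p w = refl
occ-∷-not∷ true  p w = refl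

occ-not∷-∷ : ∀ a p w → occ (not a ∷ p) (a ∷ w) ≡ occ (not a ∷ p) w
occ-not∷-∷ false p w = refl
occ-not∷-∷ true  p w = refl

-- not (not a) is not definitionally a, so this case needs its own lemma.
occ-∷-not∷not∷ : ∀ a p w → occ (a ∷ p) (not (not a) ∷ w) ≡ occ p w + occ (a ∷ p) w
occ-∷-not∷not∷ false p w = refl
occ-∷-not∷not∷ true  p w = refl

occ-≡0-∷ʳ : ∀ p c w → occ p (c ∷ w) ≡ 0 → occ p w ≡ 0
occ-≡0-∷ʳ (b ∷ p) c w h = m+n≡0⇒n≡0 (if does (b ≟ᵇ c) then occ p w else 0) h

occ-≡0-∷ˡ : ∀ a p w → occ p w ≡ 0 → occ (a ∷ p) w ≡ 0
occ-≡0-∷ˡ a p []      h = refl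
occ-≡0-∷ˡ a p (c ∷ w) h = cong₂ _+_ (guarded (does (a ≟ᵇ c))) (occ-≡0-∷ˡ a p w h′)
  where
  h′ : occ p w ≡ 0
  h′ = occ-≡0-∷ʳ p c w h
  guarded : ∀ b → (if b then occ p w else 0) ≡ 0
  guarded true  = h′
  guarded false = refl

jointly : ℕ → ℕ → Bool → Word → Word → Bool
jointly k j a q w = (occ q w ≡ᵇ k) ∧ (occ (a ∷ q) w ≡ᵇ j)

jointly-∷-not∷ : ∀ k j a q w → jointly k j a (a ∷ q) (not a ∷ w) ≡ jointly k j a (a ∷ q) w
jointly-∷-not∷ k j false q w = refl
jointly-∷-not∷ k j true  q w = refl

twiceAcross : Bool → Word → Word → Bool
twiceAcross a q w = ((occ q w + occ (not a ∷ q) w) ≡ᵇ 2) ∧ (occ (a ∷ not a ∷ q) w ≡ᵇ 0)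

count-letter : ∀ a m k → count m (λ w → occ (a ∷ []) w ≡ᵇ k) ≡ m C k
count-letter a zero    zero    = refl
count-letter a zero    (suc k) = refl
count-letter a (suc m) k = trans (count-step a m (λ w → occ (a ∷ []) w ≡ᵇ k) on-a on-not-a) (pascal k)
  where
  on-a : ∀ w → (occ (a ∷ []) (a ∷ w) ≡ᵇ k) ≡ (suc (occ (a ∷ []) w) ≡ᵇ k)
  on-a w = cong (_≡ᵇ k) (occ-∷-∷ a [] w)
  on-not-a : ∀ w → (occ (a ∷ []) (not a ∷ w) ≡ᵇ k) ≡ (occ (a ∷ []) w ≡ᵇ k)
  on-not-a w = cong (_≡ᵇ k) (occ-∷-not∷ a [] w)
  pascal : ∀ k → count m (λ w → suc (occ (a ∷ []) w) ≡ᵇ k) + count m (λ w → occ (a ∷ []) w ≡ᵇ k) ≡ suc m C k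
  pascal zero    = cong₂ _+_ (count-none m) (count-letter a m 0)
  pascal (suc k) = trans (cong₂ _+_ (count-letter a m k) (count-letter a m (suc k))) (nCk+nC[k+1]≡[n+1]C[k+1] m k)

count-jointly-1-0 : ∀ a ss m → count m (jointly 1 0 a (trail a ss)) ≡ shiftedC (length (laterRuns ss)) m (repeats ss)
count-jointly-1-0 a []           m       = count-letter a m 0
count-jointly-1-0 a (false ∷ ss) zero    = sym (shiftedC-0 (length (laterRuns ss)) (repeats ss))
count-jointly-1-0 a (true ∷ ss)  zero    = refl
count-jointly-1-0 a (false ∷ ss) (suc m) = begin
  count (suc m) (jointly 1 0 a (a ∷ q))
    ≡⟨ count-step a m (jointly 1 0 a (a ∷ q)) on-a (jointly-∷-not∷ 1 0 a q) ⟩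
  count m (jointly 1 0 a q) + count m (jointly 1 0 a (a ∷ q))
    ≡⟨ cong₂ _+_ (count-jointly-1-0 a ss m) (count-jointly-1-0 a (false ∷ ss) m) ⟩
  shiftedC r m (repeats ss) + shiftedC r m (suc (repeats ss))
    ≡⟨ shiftedC-pascal r m (repeats ss) ⟩
  shiftedC r (suc m) (suc (repeats ss)) ∎
  where
  q = trail a ss
  r = length (laterRuns ss)
  on-a : ∀ w → jointly 1 0 a (a ∷ q) (a ∷ w) ≡ jointly 1 0 a q w
  on-a w rewrite occ-∷-∷ a q w | occ-∷-∷ a (a ∷ q) w =
    x+y≡ᵇk∧y+z≡ᵇ0 1 (occ q w) _ _ (occ-≡0-∷ˡ a (a ∷ q) w)
count-jointly-1-0 a (true ∷ ss)  (suc m) =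
  trans (count-step a m (jointly 1 0 a (not a ∷ q)) on-a on-not-a)
        (cong₂ _+_ (count-none m) (count-jointly-1-0 (not a) ss m))
  where
  q = trail (not a) ss
  on-a : ∀ w → jointly 1 0 a (not a ∷ q) (a ∷ w) ≡ false
  on-a w rewrite occ-not∷-∷ a q w | occ-∷-∷ a (not a ∷ q) w = y≡ᵇ1+k∧y+z≡ᵇ0 0 (occ (not a ∷ q) w) _
  on-not-a : ∀ w → jointly 1 0 a (not a ∷ q) (not a ∷ w) ≡ jointly 1 0 (not a) q w
  on-not-a w rewrite occ-∷-∷ (not a) q w | occ-∷-not∷ a (not a ∷ q) w =
    x+y≡ᵇ1∧z≡ᵇ0 (occ q w) _ _ (occ-≡0-∷ˡ (not a) q w) (occ-≡0-∷ˡ a (not a ∷ q) w)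

mutual
  count-jointly-2-0 : ∀ a ss m → count m (jointly 2 0 a (trail a ss))
                                 ≡ singletons (laterRuns ss) * shiftedC (length (runs ss)) m (repeats ss)
  count-jointly-2-0 a []           m       = count-none m
  count-jointly-2-0 a (s ∷ ss)     zero    = sym (*-zeroʳ (singletons (laterRuns (s ∷ ss))))
  count-jointly-2-0 a (false ∷ ss) (suc m) = begin
    count (suc m) (jointly 2 0 a (a ∷ q))
      ≡⟨ count-step a m (jointly 2 0 a (a ∷ q)) on-a (jointly-∷-not∷ 2 0 a q) ⟩
    count m (jointly 2 0 a q) + count m (jointly 2 0 a (a ∷ q))
      ≡⟨ cong₂ _+_ (count-jointly-2-0 a ss m) (count-jointly-2-0 a (false ∷ ss) m) ⟩
    t * shiftedC r m e + t * shiftedC r m (suc e)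
      ≡⟨ *-shiftedC-pascal t r m e ⟩
    t * shiftedC r (suc m) (suc e) ∎
    where
    q = trail a ss
    t = singletons (laterRuns ss)
    r = length (runs ss)
    e = repeats ss
    on-a : ∀ w → jointly 2 0 a (a ∷ q) (a ∷ w) ≡ jointly 2 0 a q w
    on-a w rewrite occ-∷-∷ a q w | occ-∷-∷ a (a ∷ q) w =
      x+y≡ᵇk∧y+z≡ᵇ0 2 (occ q w) _ _ (occ-≡0-∷ˡ a (a ∷ q) w)
  count-jointly-2-0 a (true ∷ ss)  (suc m) =
    trans (count-step a m (jointly 2 0 a (not a ∷ q)) on-a on-not-a)
          (cong₂ _+_ (count-none m) (count-twiceAcross a ss m))
    where
    q = trail (not a) ss
    on-a : ∀ w → jointly 2 0 a (not a ∷ q) (a ∷ w) ≡ false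
    on-a w rewrite occ-not∷-∷ a q w | occ-∷-∷ a (not a ∷ q) w = y≡ᵇ1+k∧y+z≡ᵇ0 1 (occ (not a ∷ q) w) _
    on-not-a : ∀ w → jointly 2 0 a (not a ∷ q) (not a ∷ w) ≡ twiceAcross a q w
    on-not-a w rewrite occ-∷-∷ (not a) q w | occ-∷-not∷ a (not a ∷ q) w = refl

  count-twiceAcross : ∀ a ss m → count m (twiceAcross a (trail (not a) ss))
                                 ≡ singletons (runs ss) * shiftedC (length (runs ss)) m (repeats ss)
  count-twiceAcross a []           m       = trans (count-jointly-1-0 a (true ∷ []) m) (sym (+-identityʳ _))
  count-twiceAcross a (s ∷ ss)     zero    = sym (*-zeroʳ (singletons (runs (s ∷ ss))))
  count-twiceAcross a (false ∷ ss) (suc m) = begin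
    count (suc m) (twiceAcross a (not a ∷ q))
      ≡⟨ count-step a m (twiceAcross a (not a ∷ q)) on-a on-not-a ⟩
    count m (jointly 2 0 (not a) (not a ∷ q)) + count m (jointly 2 0 (not a) q)
      ≡⟨ cong₂ _+_ (count-jointly-2-0 (not a) (false ∷ ss) m) (count-jointly-2-0 (not a) ss m) ⟩
    t * shiftedC r m (suc e) + t * shiftedC r m e
      ≡⟨ +-comm (t * shiftedC r m (suc e)) _ ⟩
    t * shiftedC r m e + t * shiftedC r m (suc e)
      ≡⟨ *-shiftedC-pascal t r m e ⟩
    t * shiftedC r (suc m) (suc e) ∎
    where
    q = trail (not a) ss
    t = singletons (laterRuns ss)
    r = length (runs ss)
    e = repeats ss
    on-a : ∀ w → twiceAcross a (not a ∷ q) (a ∷ w) ≡ jointly 2 0 (not a) (not a ∷ q) w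
    on-a w rewrite occ-not∷-∷ a q w | occ-not∷-∷ a (not a ∷ q) w | occ-∷-∷ a (not a ∷ not a ∷ q) w =
      x+y≡ᵇk∧y+z≡ᵇ0 2 (occ (not a ∷ q) w) _ _ (occ-≡0-∷ˡ a (not a ∷ not a ∷ q) w)
    on-not-a : ∀ w → twiceAcross a (not a ∷ q) (not a ∷ w) ≡ jointly 2 0 (not a) q w
    on-not-a w rewrite occ-∷-∷ (not a) q w | occ-∷-∷ (not a) (not a ∷ q) w | occ-∷-not∷ a (not a ∷ not a ∷ q) w =
      x+y+[y+z]≡ᵇ2∧t≡ᵇ0 (occ q w) _ _ _ (occ-≡0-∷ˡ (not a) q w) (occ-≡0-∷ˡ (not a) (not a ∷ q) w)
                                        (occ-≡0-∷ˡ a (not a ∷ not a ∷ q) w)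
  count-twiceAcross a (true ∷ ss)  (suc m) =
    trans (count-step (not a) m (twiceAcross a q₀) on-not-a on-a)
          (cong₂ _+_ (count-jointly-1-0 (not a) (true ∷ ss) m) (count-twiceAcross (not a) ss m))
    where
    q  = trail (not (not a)) ss
    q₀ = not (not a) ∷ q
    on-not-a : ∀ w → twiceAcross a q₀ (not a ∷ w) ≡ jointly 1 0 (not a) q₀ w
    on-not-a w rewrite occ-not∷-∷ (not a) q w | occ-∷-∷ (not a) q₀ w | occ-∷-not∷ a (not a ∷ q₀) w =
      y+[y+z]≡ᵇ2∧t≡ᵇ0 (occ q₀ w) _ _ (occ-≡0-∷ˡ (not a) q₀ w) (occ-≡0-∷ˡ a (not a ∷ q₀) w)
    on-a : ∀ w → twiceAcross a q₀ (not (not a) ∷ w) ≡ twiceAcross (not a) q w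
    on-a w rewrite occ-∷-∷ (not (not a)) q w | occ-∷-not∷ (not a) q₀ w | occ-∷-not∷not∷ a (not a ∷ q₀) w =
      x+y≡ᵇk∧y+z≡ᵇ0 2 (occ q w + occ q₀ w) _ _ (occ-≡0-∷ˡ a (not a ∷ q₀) w)

count-jointly-1-1 : ∀ a s ss m → count m (jointly 1 1 a (trail a (s ∷ ss)))
                                 ≡ isSingleton (firstRun (s ∷ ss)) * shiftedC (length (runs (s ∷ ss))) m (repeats (s ∷ ss))
count-jointly-1-1 a s     ss zero    = sym (*-zeroʳ (isSingleton (firstRun (s ∷ ss))))
count-jointly-1-1 a false ss (suc m) =
  trans (count-step a m (jointly 1 1 a (a ∷ q)) on-a (jointly-∷-not∷ 1 1 a q))
        (cong₂ _+_ (count-none m) (count-jointly-1-1 a false ss m))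
  where
  q = trail a ss
  on-a : ∀ w → jointly 1 1 a (a ∷ q) (a ∷ w) ≡ false
  on-a w rewrite occ-∷-∷ a q w | occ-∷-∷ a (a ∷ q) w =
    x+y≡ᵇ1∧y+z≡ᵇ1 (occ q w) _ _ (occ-≡0-∷ˡ a q w) (occ-≡0-∷ˡ a (a ∷ q) w)
count-jointly-1-1 a true  ss (suc m) =
  trans (count-step a m (jointly 1 1 a (not a ∷ q)) on-a on-not-a)
        (cong₂ _+_ (count-jointly-1-0 a (true ∷ ss) m) (count-none m))
  where
  q = trail (not a) ss
  on-a : ∀ w → jointly 1 1 a (not a ∷ q) (a ∷ w) ≡ jointly 1 0 a (not a ∷ q) w
  on-a w rewrite occ-not∷-∷ a q w | occ-∷-∷ a (not a ∷ q) w = y≡ᵇ1∧y+z≡ᵇ1 (occ (not a ∷ q) w) _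
  on-not-a : ∀ w → jointly 1 1 a (not a ∷ q) (not a ∷ w) ≡ false
  on-not-a w rewrite occ-∷-∷ (not a) q w | occ-∷-not∷ a (not a ∷ q) w =
    x+y≡ᵇ1∧z≡ᵇ1 (occ q w) _ _ (occ-≡0-∷ˡ (not a) q w) (occ-≡0-∷ˡ a (not a ∷ q) w)

count-occ+occ≡2 : ∀ a q m → count m (λ w → (occ q w + occ (a ∷ q) w) ≡ᵇ 2)
                              ≡ count m (jointly 1 1 a q) + count m (jointly 2 0 a q)
count-occ+occ≡2 a q m = begin
  count m sum≡2
    ≡⟨ count-partition m sum≡2 (λ w → occ (a ∷ q) w ≡ᵇ 1) ⟩
  count m (λ w → sum≡2 w ∧ (occ (a ∷ q) w ≡ᵇ 1)) + count m (λ w → sum≡2 w ∧ not (occ (a ∷ q) w ≡ᵇ 1))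
    ≡⟨ cong₂ _+_ (count-cong m (λ w → x+y≡ᵇ2∧y≡ᵇ1 (occ q w) _))
                 (count-cong m (λ w → x+y≡ᵇ2∧y≢ᵇ1 (occ q w) _ (occ-≡0-∷ˡ a q w))) ⟩
  count m (jointly 1 1 a q) + count m (jointly 2 0 a q) ∎
  where
  sum≡2 : Word → Bool
  sum≡2 w = (occ q w + occ (a ∷ q) w) ≡ᵇ 2

count-twice : ∀ a s ss m → count m (λ w → occ (a ∷ trail a (s ∷ ss)) w ≡ᵇ 2)
                           ≡ singletons (runs (s ∷ ss)) * shiftedC (length (runs (s ∷ ss))) m (suc (repeats (s ∷ ss)))
count-twice a s ss zero    = sym (*-zeroʳ (singletons (runs (s ∷ ss))))
count-twice a s ss (suc m) = begin
  count (suc m) (twice (a ∷ q))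
    ≡⟨ count-step a m (twice (a ∷ q)) (λ w → cong (_≡ᵇ 2) (occ-∷-∷ a q w)) (λ w → cong (_≡ᵇ 2) (occ-∷-not∷ a q w)) ⟩
  count m (λ w → (occ q w + occ (a ∷ q) w) ≡ᵇ 2) + count m (twice (a ∷ q))
    ≡⟨ cong (_+ count m (twice (a ∷ q))) (count-occ+occ≡2 a q m) ⟩
  (count m (jointly 1 1 a q) + count m (jointly 2 0 a q)) + count m (twice (a ∷ q))
    ≡⟨ cong₂ _+_ (cong₂ _+_ (count-jointly-1-1 a s ss m) (count-jointly-2-0 a (s ∷ ss) m)) (count-twice a s ss m) ⟩
  (f * S + l * S) + (f + l) * S′
    ≡⟨ cong (_+ (f + l) * S′) (*-distribʳ-+ S f l) ⟨
  (f + l) * S + (f + l) * S′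
    ≡⟨ *-shiftedC-pascal (f + l) r m e ⟩
  (f + l) * shiftedC r (suc m) (suc e) ∎
  where
  q = trail a (s ∷ ss)
  twice : Word → Word → Bool
  twice p w = occ p w ≡ᵇ 2
  f = isSingleton (firstRun (s ∷ ss))
  l = singletons (laterRuns (s ∷ ss))
  r = length (runs (s ∷ ss))
  e = repeats (s ∷ ss)
  S = shiftedC r m e
  S′ = shiftedC r m (suc e)

B-twice : ∀ a s ss n → let p = a ∷ trail a (s ∷ ss) in
          B n p 2 ≡ numRuns1 p * ((n ∸ numRuns p) C (length p ∸ numRuns p + 1))
B-twice a s ss n = begin
  B n p 2
    ≡⟨ B≡count n p 2 ⟩
  count n (λ w → occ p w ≡ᵇ 2)
    ≡⟨ count-twice a s ss n ⟩
  singletons (runs ss′) * shiftedC (length (runs ss′)) n (suc (repeats ss′))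
    ≡⟨ cong (singletons (runs ss′) *_) (shiftedC≡C (length (runs ss′)) n (repeats ss′)) ⟩
  singletons (runs ss′) * ((n ∸ length (runs ss′)) C suc (repeats ss′))
    ≡⟨ cong₂ _*_ (numRuns1-trail a ss′)
                 (cong₂ (λ r e → (n ∸ r) C e) (numRuns-trail a ss′)
                        (trans (cong (_+ 1) (length∸numRuns-trail a ss′)) (+-comm (repeats ss′) 1))) ⟨
  numRuns1 p * ((n ∸ numRuns p) C (length p ∸ numRuns p + 1)) ∎
  where
  ss′ = s ∷ ss
  p = a ∷ trail a ss′

mainTheorem3 : (p : Word) → (n : ℕ) →
    (length p ≥ 2 → B n p 2 ≡ numRuns1 p * ((n ∸ numRuns p) C (length p ∸ numRuns p + 1)))
    × (length p ≡ 1 → B n p 2 ≡ n C 2)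
mainTheorem3 []          n = (λ ()) , (λ ())
mainTheorem3 (a ∷ [])    n = (λ { (s≤s ()) }) , (λ _ → trans (B≡count n (a ∷ []) 2) (count-letter a n 2))
mainTheorem3 (a ∷ b ∷ q) n = (λ _ → subst Formula (cong (a ∷_) (trail-changes a (b ∷ q))) (B-twice a (a xor b) (changes b q) n))
                           , (λ ())
  where
  Formula : Word → Set
  Formula p = B n p 2 ≡ numRuns1 p * ((n ∸ numRuns p) C (length p ∸ numRuns p + 1))
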